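{- Let $Prop$ be a finite set of propositional variables and let $L$ be a language interpreted in team semantics over $Prop$ that contains the connectives $\wedge$ and $\vee$ (with the semantics given in the context) and that can express all flat team propositions, i.e., for every flat team proposition $\mathbb{P}$ there is a formula $\alpha$ of $L$ with $\llbracket \alpha\rrbracket=\mathbb{P}$. Let $\varphi$ be a formula of $L$. Then $\varphi$ is downward closed if and only if $\varphi\wedge(\psi\vee\chi)\models(\varphi\wedge\psi)\vee(\varphi\wedge\chi)$ holds for all formulas $\psi,\chi$ of $L$.
   Context: A valuation is a function $v:Prop\to\{0,1\}$; a team is a set of valuations. Each formula $\varphi$ is evaluated on teams by a satisfaction relation $T\models\varphi$; $\llbracket\varphi\rrbracket=\{T\subseteq\{0,1\}^{Prop}: T\models\varphi\}$. A team proposition is a set of teams. Semantics: $T\models\varphi\wedge\psi$ iff $T\models\varphi$ and $T\models\psi$; $T\models\varphi\vee\psi$ iff there are $T_1,T_2$ with $T=T_1\cup T_2$, $T_1\models\varphi$ and $T_2\models\psi$. A formula (or team proposition) is downward closed if $T\models\varphi$ and $S\subseteq T$ imply $S\models\varphi$. A team proposition $\mathbb{P}$ is flat if $T\in\mathbb{P}$ iff $\{v\}\in\mathbb{P}$ for all $v\in T$ (for $T$ ranging over all teams, including $\emptyset$). Entailment: $\Gamma\models\psi$ iff every team satisfying all formulas in $\Gamma$ satisfies $\psi$. -}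

module Defs where

open import Data.Nat using (ℕ)
open import Data.Bool using (Bool; true; false; _∨_; if_then_else_)
open import Data.Vec using (Vec)
open import Data.Vec.Properties using (≡-dec)
open import Data.Bool.Properties using () renaming (_≟_ to _≟ᵇ_)
open import Data.Product using (Σ; _×_; ∃-syntax)
open import Relation.Nullary using (does)
open import Relation.Binary.PropositionalEquality using (_≡_)

-- Prop = Fin n (n propositional variables); a valuation assigns a truth
-- value to each variable.
Valuation : ℕ → Set
Valuation n = Vec Bool n

-- A team is a set of valuations, given by its (decidable) characteristic
-- function (the space of valuations is finite).
Team : ℕ → Set
Team n = Valuation n → Bool

module _ {n : ℕ} where

  _∈ₜ_ : Valuation n → Team n → Set
  v ∈ₜ T = T v ≡ true

  _⊆ₜ_ : Team n → Team n → Set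
  S ⊆ₜ T = ∀ v → v ∈ₜ S → v ∈ₜ T

  _≐_ : Team n → Team n → Set
  S ≐ T = ∀ v → S v ≡ T v

  _∪ₜ_ : Team n → Team n → Team n
  (S ∪ₜ T) v = S v ∨ T v

  ⟨_⟩ : Valuation n → Team n
  ⟨ v ⟩ w = does (≡-dec _≟ᵇ_ w v)

  TeamProp : Set₁
  TeamProp = Team n → Set

  -- flatness: T ∈ P iff {v} ∈ P for all v ∈ T (for all teams T, incl. ∅)
  Flat : TeamProp → Set
  Flat P = ∀ T → (P T → ∀ v → v ∈ₜ T → P ⟨ v ⟩)
                × ((∀ v → v ∈ₜ T → P ⟨ v ⟩) → P T)

record Language (n : ℕ) : Set₁ where
  field
    Form : Set
    _⊨_  : Team n → Form → Set
    -- satisfaction depends only on the team as a set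
    ⊨-resp-≐ : ∀ {S T} φ → S ≐ T → S ⊨ φ → T ⊨ φ
    _∧ᶠ_ : Form → Form → Form
    _∨ᶠ_ : Form → Form → Form
    ∧-sem : ∀ T φ ψ → (T ⊨ (φ ∧ᶠ ψ) → (T ⊨ φ) × (T ⊨ ψ))
                    × ((T ⊨ φ) × (T ⊨ ψ) → T ⊨ (φ ∧ᶠ ψ))
    ∨-sem : ∀ T φ ψ →
      (T ⊨ (φ ∨ᶠ ψ) → ∃[ T₁ ] ∃[ T₂ ] (T ≐ (T₁ ∪ₜ T₂)) × (T₁ ⊨ φ) × (T₂ ⊨ ψ))
      × (∃[ T₁ ] ∃[ T₂ ] (T ≐ (T₁ ∪ₜ T₂)) × (T₁ ⊨ φ) × (T₂ ⊨ ψ) → T ⊨ (φ ∨ᶠ ψ))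
    expressesFlat : (P : TeamProp {n}) → Flat P →
      Σ Form (λ α → ∀ T → (T ⊨ α → P T) × (P T → T ⊨ α))

  DownwardClosed : Form → Set
  DownwardClosed φ = ∀ S T → T ⊨ φ → S ⊆ₜ T → S ⊨ φ

  _⊫_ : Form → Form → Set
  φ ⊫ ψ = ∀ T → T ⊨ φ → T ⊨ ψ

{-# OPTIONS --safe #-}
-- Distributivity of φ ∧ (ψ ∨ χ) is exactly what downward closure of φ buys:
-- if φ is downward closed, the split T = T₁ ∪ T₂ witnessing ψ ∨ χ also
-- witnesses (φ ∧ ψ) ∨ (φ ∧ χ). Conversely, given S ⊆ T ⊨ φ, take the flat
-- propositions "every member lies in S" (ψ) and "no member lies in S" (χ).
-- T = S ∪ (T ∖ S) satisfies ψ ∨ χ, so distributivity splits T = T₁ ∪ T₂ with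
-- T₁ ⊨ φ ∧ ψ and T₂ ⊨ φ ∧ χ; the two conditions force T₁ = S, so S ⊨ φ.
module Submission where

open import Defs
open import Data.Nat using (ℕ)
open import Data.Bool using (true; false; _∨_; _∧_; not)
open import Data.Bool.Properties using (⇔→≡; ∧-identityʳ; ∧-zeroʳ) renaming (_≟_ to _≟ᵇ_)
open import Data.Vec.Properties using (≡-dec)
open import Data.Product using (_×_; _,_; proj₁; proj₂; ∃-syntax)
open import Function using (id)
open import Function.Bundles using (mk⇔)
open import Relation.Nullary.Decidable using (yes; no; dec-true)
open import Relation.Binary.PropositionalEquality using (_≡_; refl; sym; trans; subst)

x≡true⇒x∨y≡true : ∀ {x} y → x ≡ true → x ∨ y ≡ true
x≡true⇒x∨y≡true _ refl = refl

y≡true⇒x∨y≡true : ∀ x {y} → y ≡ true → x ∨ y ≡ true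
y≡true⇒x∨y≡true false y≡true = y≡true
y≡true⇒x∨y≡true true  _      = refl

x∨y≡true∧y≡false⇒x≡true : ∀ {x y} → x ∨ y ≡ true → y ≡ false → x ≡ true
x∨y≡true∧y≡false⇒x≡true {true}  _         _ = refl
x∨y≡true∧y≡false⇒x≡true {false} x∨y≡true refl = x∨y≡true

module _ {n : ℕ} where

  _∉ₜ_ : Valuation n → Team n → Set
  v ∉ₜ T = T v ≡ false

  _∖ₜ_ : Team n → Team n → Team n
  (T ∖ₜ S) v = T v ∧ not (S v)

  ≐-sym : {S T : Team n} → S ≐ T → T ≐ S
  ≐-sym S≐T v = sym (S≐T v)

  ⊆-respʳ-≐ : {S T U : Team n} → T ≐ U → S ⊆ₜ T → S ⊆ₜ U
  ⊆-respʳ-≐ T≐U S⊆T v v∈S = trans (sym (T≐U v)) (S⊆T v v∈S)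

  ⊆-antisym : {S T : Team n} → S ⊆ₜ T → T ⊆ₜ S → S ≐ T
  ⊆-antisym S⊆T T⊆S v = ⇔→≡ (mk⇔ (S⊆T v) (T⊆S v))

  ⊆-∪ˡ : (S T : Team n) → S ⊆ₜ (S ∪ₜ T)
  ⊆-∪ˡ S T v v∈S = x≡true⇒x∨y≡true (T v) v∈S

  ⊆-∪ʳ : (S T : Team n) → T ⊆ₜ (S ∪ₜ T)
  ⊆-∪ʳ S T v v∈T = y≡true⇒x∨y≡true (S v) v∈T

  ∪-∖ : {S T : Team n} → S ⊆ₜ T → T ≐ (S ∪ₜ (T ∖ₜ S))
  ∪-∖ {S} {T} S⊆T v with S v in v∈?S
  ... | true  = S⊆T v v∈?S
  ... | false = sym (∧-identityʳ (T v))

  ∖-disjoint : (S T : Team n) → ∀ v → v ∈ₜ (T ∖ₜ S) → v ∉ₜ S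
  ∖-disjoint S T v v∈T∖S with S v
  ... | false = refl
  ... | true  with () ← trans (sym (∧-zeroʳ (T v))) v∈T∖S

  ⊆-∪-disjoint : {S T₁ T₂ : Team n} → S ⊆ₜ (T₁ ∪ₜ T₂) →
                 (∀ v → v ∈ₜ T₂ → v ∉ₜ S) → S ⊆ₜ T₁
  ⊆-∪-disjoint {S} {T₁} {T₂} S⊆T₁∪T₂ T₂∩S≡∅ v v∈S with T₂ v in v∈?T₂
  ... | false = x∨y≡true∧y≡false⇒x≡true (S⊆T₁∪T₂ v v∈S) v∈?T₂
  ... | true  with () ← trans (sym v∈S) (T₂∩S≡∅ v v∈?T₂)

  ∈-⟨⟩ : (v : Valuation n) → v ∈ₜ ⟨ v ⟩
  ∈-⟨⟩ v = dec-true (≡-dec _≟ᵇ_ v v) refl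

  ∈-⟨⟩⁻¹ : {v w : Valuation n} → w ∈ₜ ⟨ v ⟩ → w ≡ v
  ∈-⟨⟩⁻¹ {v} {w} w∈⟨v⟩ with ≡-dec _≟ᵇ_ w v
  ... | yes w≡v = w≡v
  ... | no _    with () ← w∈⟨v⟩

  Pointwise : (Valuation n → Set) → TeamProp {n}
  Pointwise Q T = ∀ v → v ∈ₜ T → Q v

  Pointwise-flat : (Q : Valuation n → Set) → Flat (Pointwise Q)
  Pointwise-flat Q T = singletons , λ Q⟨v⟩ v v∈T → Q⟨v⟩ v v∈T v (∈-⟨⟩ v)
    where
    singletons : Pointwise Q T → ∀ v → v ∈ₜ T → Pointwise Q ⟨ v ⟩
    singletons QT v v∈T w w∈⟨v⟩ = subst Q (sym (∈-⟨⟩⁻¹ w∈⟨v⟩)) (QT v v∈T)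

module Connectives {n : ℕ} (L : Language n) where
  open Language L

  ∧-intro : ∀ {T φ ψ} → T ⊨ φ → T ⊨ ψ → T ⊨ (φ ∧ᶠ ψ)
  ∧-intro {T} {φ} {ψ} T⊨φ T⊨ψ = proj₂ (∧-sem T φ ψ) (T⊨φ , T⊨ψ)

  ∧-elimˡ : ∀ {T φ ψ} → T ⊨ (φ ∧ᶠ ψ) → T ⊨ φ
  ∧-elimˡ {T} {φ} {ψ} T⊨φ∧ψ = proj₁ (proj₁ (∧-sem T φ ψ) T⊨φ∧ψ)

  ∧-elimʳ : ∀ {T φ ψ} → T ⊨ (φ ∧ᶠ ψ) → T ⊨ ψ
  ∧-elimʳ {T} {φ} {ψ} T⊨φ∧ψ = proj₂ (proj₁ (∧-sem T φ ψ) T⊨φ∧ψ)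

  ∨-intro : ∀ {T φ ψ} T₁ T₂ → T ≐ (T₁ ∪ₜ T₂) → T₁ ⊨ φ → T₂ ⊨ ψ → T ⊨ (φ ∨ᶠ ψ)
  ∨-intro {T} {φ} {ψ} T₁ T₂ T≐T₁∪T₂ T₁⊨φ T₂⊨ψ =
    proj₂ (∨-sem T φ ψ) (T₁ , T₂ , T≐T₁∪T₂ , T₁⊨φ , T₂⊨ψ)

  ∨-elim : ∀ {T φ ψ} → T ⊨ (φ ∨ᶠ ψ) →
           ∃[ T₁ ] ∃[ T₂ ] (T ≐ (T₁ ∪ₜ T₂)) × (T₁ ⊨ φ) × (T₂ ⊨ ψ)
  ∨-elim {T} {φ} {ψ} = proj₁ (∨-sem T φ ψ)

  ⌜_⌝ : (Valuation n → Set) → Form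
  ⌜ Q ⌝ = proj₁ (expressesFlat (Pointwise Q) (Pointwise-flat Q))

  ⊨⌜⌝⇒Pointwise : ∀ {Q T} → T ⊨ ⌜ Q ⌝ → Pointwise Q T
  ⊨⌜⌝⇒Pointwise {Q} {T} = proj₁ (proj₂ (expressesFlat (Pointwise Q) (Pointwise-flat Q)) T)

  Pointwise⇒⊨⌜⌝ : ∀ {Q T} → Pointwise Q T → T ⊨ ⌜ Q ⌝
  Pointwise⇒⊨⌜⌝ {Q} {T} = proj₂ (proj₂ (expressesFlat (Pointwise Q) (Pointwise-flat Q)) T)

  Distributive : Form → Set
  Distributive φ = ∀ ψ χ → (φ ∧ᶠ (ψ ∨ᶠ χ)) ⊫ ((φ ∧ᶠ ψ) ∨ᶠ (φ ∧ᶠ χ))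

  DownwardClosed⇒Distributive : ∀ {φ} → DownwardClosed φ → Distributive φ
  DownwardClosed⇒Distributive {φ} dc ψ χ T T⊨φ∧[ψ∨χ]
    with T₁ , T₂ , T≐T₁∪T₂ , T₁⊨ψ , T₂⊨χ ← ∨-elim (∧-elimʳ T⊨φ∧[ψ∨χ]) =
    ∨-intro T₁ T₂ T≐T₁∪T₂ (∧-intro (restrict (⊆-∪ˡ T₁ T₂)) T₁⊨ψ)
                          (∧-intro (restrict (⊆-∪ʳ T₁ T₂)) T₂⊨χ)
    where
    restrict : ∀ {U} → U ⊆ₜ (T₁ ∪ₜ T₂) → U ⊨ φ
    restrict U⊆T₁∪T₂ =
      dc _ T (∧-elimˡ T⊨φ∧[ψ∨χ]) (⊆-respʳ-≐ (≐-sym T≐T₁∪T₂) U⊆T₁∪T₂)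

  Distributive⇒DownwardClosed : ∀ {φ} → Distributive φ → DownwardClosed φ
  Distributive⇒DownwardClosed {φ} dist S T T⊨φ S⊆T =
    fromSplit (∨-elim (dist ψ χ T (∧-intro T⊨φ T⊨ψ∨χ)))
    where
    ψ χ : Form
    ψ = ⌜ _∈ₜ S ⌝
    χ = ⌜ _∉ₜ S ⌝

    T⊨ψ∨χ : T ⊨ (ψ ∨ᶠ χ)
    T⊨ψ∨χ = ∨-intro S (T ∖ₜ S) (∪-∖ S⊆T)
              (Pointwise⇒⊨⌜⌝ (λ _ → id)) (Pointwise⇒⊨⌜⌝ (∖-disjoint S T))

    fromSplit : ∃[ T₁ ] ∃[ T₂ ] (T ≐ (T₁ ∪ₜ T₂)) × (T₁ ⊨ (φ ∧ᶠ ψ)) × (T₂ ⊨ (φ ∧ᶠ χ)) →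
                S ⊨ φ
    fromSplit (T₁ , T₂ , T≐T₁∪T₂ , T₁⊨φ∧ψ , T₂⊨φ∧χ) =
      ⊨-resp-≐ φ (⊆-antisym T₁⊆S S⊆T₁) (∧-elimˡ T₁⊨φ∧ψ)
      where
      T₁⊆S : T₁ ⊆ₜ S
      T₁⊆S = ⊨⌜⌝⇒Pointwise (∧-elimʳ T₁⊨φ∧ψ)

      S⊆T₁ : S ⊆ₜ T₁
      S⊆T₁ = ⊆-∪-disjoint (⊆-respʳ-≐ T≐T₁∪T₂ S⊆T) (⊨⌜⌝⇒Pointwise (∧-elimʳ T₂⊨φ∧χ))

proposition1 : (n : ℕ) (L : Language n) (φ : Language.Form L) →
    let open Language L in
    (DownwardClosed φ → ∀ ψ χ → (φ ∧ᶠ (ψ ∨ᶠ χ)) ⊫ ((φ ∧ᶠ ψ) ∨ᶠ (φ ∧ᶠ χ)))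
    × ((∀ ψ χ → (φ ∧ᶠ (ψ ∨ᶠ χ)) ⊫ ((φ ∧ᶠ ψ) ∨ᶠ (φ ∧ᶠ χ))) → DownwardClosed φ)
proposition1 n L φ = DownwardClosed⇒Distributive , Distributive⇒DownwardClosed
  where open Connectives L
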